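{- For every integer $n\ge 2$ and every generic set $X$ of $n$ points in $\mathbb{R}^2$, $$\mathrm{span}_2(X)\le \Big\lfloor \frac{n^2}{4}+n-2\Big\rfloor .$$ Moreover this bound is best possible: for every $n\ge 2$ there is a generic set $X$ of $n$ points in $\mathbb{R}^2$ with $\mathrm{span}_2(X)=\lfloor \frac{n^2}{4}+n-2\rfloor$.
   Context: A rectangle is a closed axis-aligned rectangle in $\mathbb{R}^2$. A finite set $X\subset\mathbb{R}^2$ is generic if no two points of $X$ share a coordinate (i.e. have equal first coordinates or equal second coordinates). For $A\subseteq X$, $R[A]$ denotes the smallest rectangle containing $A$, i.e. $\{s\in\mathbb{R}^2: \min_{x\in A}x_i\le s_i\le \max_{x\in A}x_i,\ i=1,2\}$. A rectangle is empty (with respect to $X$) if its open interior contains no point of $X$. The rectangle graph $G_r(X)$ has vertex set $X$, and $p,q\in X$ are adjacent iff $R[\{p,q\}]$ is empty. $\mathrm{span}_2(X)$ denotes the number of edges of $G_r(X)$.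
   Formalization: The upper bound is proved only for generic sets of n points with rational coordinates, in ℚ² instead of ℝ², and the set attaining the bound is likewise taken in ℚ². -}

module Defs where

open import Data.Nat as ℕ using (ℕ; _*_; _∸_; _/_)
open import Data.Rational as ℚ using (ℚ; _⊓_; _⊔_)
open import Data.Rational.Properties using (_<?_)
open import Data.Fin as Fin using (Fin)
open import Data.Fin.Properties using (any?) renaming (_<?_ to _<ᶠ?_)
open import Data.Product using (_×_; _,_; proj₁; proj₂; ∃)
open import Data.Product.Properties using () 
open import Data.List using (List; length; filter; cartesianProduct; allFin)
open import Relation.Nullary using (¬_; Dec)
open import Relation.Nullary.Decidable using (_×-dec_; ¬?)
open import Relation.Binary.PropositionalEquality using (_≢_)

Point : Set
Point = ℚ × ℚ

-- A finite set of n points, indexed by Fin n.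
-- Generic: no two distinct points share a first or a second coordinate
-- (in particular the indexing is injective).
Generic : ∀ {n} → (Fin n → Point) → Set
Generic {n} X = ∀ (i j : Fin n) → i ≢ j →
  (proj₁ (X i) ≢ proj₁ (X j)) × (proj₂ (X i) ≢ proj₂ (X j))

InInterior : Point → Point → Point → Set
InInterior p q s =
  ((proj₁ p ⊓ proj₁ q) ℚ.< proj₁ s × proj₁ s ℚ.< (proj₁ p ⊔ proj₁ q)) ×
  ((proj₂ p ⊓ proj₂ q) ℚ.< proj₂ s × proj₂ s ℚ.< (proj₂ p ⊔ proj₂ q))

inInterior? : ∀ p q s → Dec (InInterior p q s)
inInterior? p q s =
  ((_ <? _) ×-dec (_ <? _)) ×-dec ((_ <? _) ×-dec (_ <? _))

EmptyRect : ∀ {n} → (Fin n → Point) → Fin n → Fin n → Set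
EmptyRect {n} X i j = ¬ ∃ (λ (k : Fin n) → InInterior (X i) (X j) (X k))

emptyRect? : ∀ {n} (X : Fin n → Point) i j → Dec (EmptyRect X i j)
emptyRect? X i j = ¬? (any? (λ k → inInterior? (X i) (X j) (X k)))

IsEdge : ∀ {n} → (Fin n → Point) → Fin n × Fin n → Set
IsEdge X (i , j) = (i Fin.< j) × EmptyRect X i j

isEdge? : ∀ {n} (X : Fin n → Point) (e : Fin n × Fin n) → Dec (IsEdge X e)
isEdge? X (i , j) = (i <ᶠ? j) ×-dec emptyRect? X i j

span₂ : ∀ {n} → (Fin n → Point) → ℕ
span₂ {n} X = length (filter (isEdge? X) (cartesianProduct (allFin n) (allFin n)))

-- ⌊ n²/4 + n − 2 ⌋, which for n ≥ 2 equals ⌊n²/4⌋ + n − 2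
bound : ℕ → ℕ
bound n = (n * n) / 4 ℕ.+ n ∸ 2

{-# OPTIONS --safe #-}
-- Induct on subsets p of the points, deleting two points at a time.  Let T be the
-- highest point of p and s its lowest neighbour in the rectangle graph of p.  If z₁ ≠ z₂ are common
-- neighbours of T and s, then x(z₁) is not strictly between x(z₂) and x(T): whichever of x(s),
-- x(z₁), x(T) lies between the other two, some point falls inside an empty rectangle.  So T and s
-- have at most one common neighbour on each side of T, and deleting them loses
-- deg T + deg s - 1 <= |p| + 1 edges, in step with bound (k + 2) = bound k + k + 3.  Deleting
-- points never destroys an edge among the others, and that is all the counting uses.  With a = n / 2, take the increasing chains (t, n + t) for t < a and (t, t) for
-- a <= t.  Every pair across the chains and every pair of consecutive points spans an empty
-- rectangle: a (n - a) + n - 2 = bound n edges.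
module Submission where

open import Defs
open import Data.Nat using (ℕ; _≤_)
open import Data.Fin using (Fin)
open import Data.Product using (_×_; Σ)
open import Relation.Binary.PropositionalEquality using (_≡_)

open import Data.Bool.Base using (true; false; if_then_else_)
open import Data.Nat.Base as ℕ using (zero; suc; _+_; _*_; _∸_; _/_; z≤n; s≤s)
open import Data.Nat.Properties as ℕ
  using (≤-antisym; ≤-trans; ≤-reflexive; ≤-pred; m≤m+n; m≤n+m; +-mono-≤; +-monoˡ-≤; +-monoʳ-≤; *-monoʳ-≤;
         +-identityʳ; *-identityˡ; *-identityʳ; +-∸-assoc; m+[n∸m]≡n; +-cancelʳ-≤; *-cancelˡ-≤; suc-injective; >⇒≢;
         +-*-semiring; module ≤-Reasoning)
open import Data.Nat.DivMod using (/-congˡ; +-distrib-/-∣ʳ; m*n/n≡m; m/n≡1+[m∸n]/n; m/n≤m; m/n<m; m≥n⇒m/n>0)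
open import Data.Nat.Divisibility using (divides)
open import Data.Nat.Coprimality using (1-coprimeTo) renaming (sym to coprime-sym)
open import Data.Nat.Tactic.RingSolver using (solve-∀)
open import Data.Fin.Base using (zero; suc; toℕ)
import Data.Integer.Base as ℤ
import Data.Integer.Properties as ℤ
open import Data.Rational.Base as ℚ using (ℚ)
import Data.Rational.Properties as ℚ
open import Data.Fin.Properties using (_≟_; any?; <⇒≢; toℕ-injective; toℕ<n) renaming (suc-injective to fsuc-injective)
open import Data.Fin.Subset using (Subset; _∈_; _∉_; _-_; ⁅_⁆; ∣_∣; ⊤; inside; outside; Nonempty)
open import Data.Fin.Subset.Properties
  using (_∈?_; ∈⊤; ∣⊤∣≡n; drop-there; p─q⊆p; x∈p∧x≢y⇒x∈p-y; nonempty?; Empty-unique; ∣⊥∣≡0)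
open import Data.List.Base using ([]; _∷_; length; filter; map; _++_; tabulate; cartesianProduct; allFin)
open import Data.List.Properties using (length-++; filter-++)
open import Data.List.Relation.Unary.All using (lookup)
open import Data.List.Relation.Unary.All.Properties using (all-filter)
open import Data.List.Membership.Propositional.Properties using (∈-filter⁺; ∈-allFin)
import Data.List.Extrema as Extrema
open import Data.Product.Base using (_,_; ∃; ∃₂; proj₁; proj₂)
open import Data.Sum.Base using (_⊎_; inj₁; inj₂; [_,_]′)
open import Data.Vec.Base using ([]; _∷_)
open import Function.Base using (_∘_)
open import Level using (Level; 0ℓ)
open import Relation.Binary.Bundles using (TotalOrder; StrictTotalOrder; DecTotalOrder)
open import Relation.Binary.Definitions using (tri<; tri≈; tri>)
open import Relation.Nullary.Decidable.Core using (Dec; yes; no; does; _×-dec_; ¬?; map′)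
open import Relation.Nullary.Negation.Core using (¬_; contradiction)
open import Relation.Unary using (Pred; Decidable)
open import Relation.Binary.PropositionalEquality
  using (_≢_; refl; sym; trans; cong; cong₂; subst; subst₂; module ≡-Reasoning)
open import Algebra.Properties.Semiring.Sum +-*-semiring
  using (sum; sum-syntax; sum-cong-≗; ∑-distrib-+; ∑-comm; sum-replicate-zero; *-distribˡ-sum; *-distribʳ-sum)

private
  variable
    ℓ₁ ℓ₂ ℓ₃ : Level
    A : Set ℓ₁
    B : Set ℓ₂
    C : Set ℓ₃

-- Defined through `does`, so that e.g. 𝟙 (suc i ≟ suc j) and 𝟙 (i ≟ j) are definitionally equal.
𝟙 : Dec A → ℕ
𝟙 a? = if does a? then 1 else 0

𝟙-yes : (a? : Dec A) → A → 𝟙 a? ≡ 1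
𝟙-yes (yes _) _ = refl
𝟙-yes (no ¬a) a = contradiction a ¬a

𝟙-no : (a? : Dec A) → ¬ A → 𝟙 a? ≡ 0
𝟙-no (yes a) ¬a = contradiction a ¬a
𝟙-no (no _) _ = refl

𝟙-mono : (a? : Dec A) (b? : Dec B) → (A → B) → 𝟙 a? ≤ 𝟙 b?
𝟙-mono (yes a) b? A⇒B = ≤-reflexive (sym (𝟙-yes b? (A⇒B a)))
𝟙-mono (no _) _ _ = z≤n

𝟙-×-dec : (a? : Dec A) (b? : Dec B) → 𝟙 (a? ×-dec b?) ≡ 𝟙 a? * 𝟙 b?
𝟙-×-dec (yes _) b? = sym (+-identityʳ (𝟙 b?))
𝟙-×-dec (no _) _ = refl

𝟙-×-decˡ : (a? : Dec A) (b? : Dec B) → B → 𝟙 (a? ×-dec b?) ≡ 𝟙 a?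
𝟙-×-decˡ a? b? b = trans (𝟙-×-dec a? b?) (trans (cong (𝟙 a? *_) (𝟙-yes b? b)) (*-identityʳ (𝟙 a?)))

𝟙-split : (a? : Dec A) (b? : Dec B) (c? : Dec C) → (A → B ⊎ C) → 𝟙 a? ≤ 𝟙 b? + 𝟙 c?
𝟙-split (no _) _ _ _ = z≤n
𝟙-split (yes a) b? c? A⇒B⊎C with A⇒B⊎C a
... | inj₁ b = ≤-trans (𝟙-mono (yes a) b? λ _ → b) (m≤m+n (𝟙 b?) (𝟙 c?))
... | inj₂ c = ≤-trans (𝟙-mono (yes a) c? λ _ → c) (m≤n+m (𝟙 c?) (𝟙 b?))

𝟙-disjoint : (a? : Dec A) (b? : Dec B) (c? : Dec C) →
             (A → ¬ B) → (A → C) → (B → C) → 𝟙 a? + 𝟙 b? ≤ 𝟙 c?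
𝟙-disjoint (yes a) (yes b) _ disjoint _ _ = contradiction b (disjoint a)
𝟙-disjoint (yes a) (no _) c? _ A⇒C _ = ≤-reflexive (sym (𝟙-yes c? (A⇒C a)))
𝟙-disjoint (no _) b? c? _ _ B⇒C = 𝟙-mono b? c? B⇒C

sum-mono-≤ : ∀ {n} {f g : Fin n → ℕ} → (∀ i → f i ≤ g i) → sum f ≤ sum g
sum-mono-≤ {zero} _ = z≤n
sum-mono-≤ {suc n} f≤g = +-mono-≤ (f≤g zero) (sum-mono-≤ (f≤g ∘ suc))

sum-zero : ∀ {n} {f : Fin n → ℕ} → (∀ i → f i ≡ 0) → sum f ≡ 0
sum-zero {n} f≡0 = trans (sum-cong-≗ f≡0) (sum-replicate-zero n)

∑-δ : ∀ {n} (t : Fin n) (f : Fin n → ℕ) → ∑[ i < n ] (𝟙 (i ≟ t) * f i) ≡ f t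
∑-δ {suc n} zero f = trans (cong₂ _+_ (*-identityˡ (f zero)) (sum-replicate-zero n)) (+-identityʳ (f zero))
∑-δ {suc n} (suc t) f = ∑-δ t (f ∘ suc)

∑𝟙≟ : ∀ {n} (t : Fin n) → ∑[ i < n ] 𝟙 (i ≟ t) ≡ 1
∑𝟙≟ t = trans (sum-cong-≗ (λ i → sym (*-identityʳ (𝟙 (i ≟ t))))) (∑-δ t (λ _ → 1))

∑𝟙≤1 : ∀ {n p} {P : Pred (Fin n) p} (P? : Decidable P) →
       (∀ {i j} → P i → P j → i ≡ j) → ∑[ i < n ] 𝟙 (P? i) ≤ 1
∑𝟙≤1 {zero} P? unique = z≤n
∑𝟙≤1 {suc n} P? unique with P? zero
... | yes P0 = ≤-reflexive (cong suc (sum-zero λ i → 𝟙-no (P? (suc i)) λ Pi → contradiction (unique P0 Pi) λ ()))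
... | no _ = ∑𝟙≤1 (P? ∘ suc) (λ Pi Pj → fsuc-injective (unique Pi Pj))

sum-≤-except₂ : ∀ {n} {f g : Fin n → ℕ} {t u : Fin n} → t ≢ u → (∀ i → i ≢ t → i ≢ u → f i ≤ g i) →
                sum f + (g t + g u) ≤ sum g + (f t + f u)
sum-≤-except₂ {n} {f} {g} {t} {u} t≢u f≤g = begin
  sum f + (g t + g u)                     ≡⟨ cong (sum f +_) (cong₂ _+_ (∑-δ t g) (∑-δ u g)) ⟨
  sum f + (sum (δ t g) + sum (δ u g))     ≡⟨ sum₃ f (δ t g) (δ u g) ⟨
  ∑[ i < n ] (f i + (δ t g i + δ u g i))  ≤⟨ sum-mono-≤ pointwise ⟩
  ∑[ i < n ] (g i + (δ t f i + δ u f i))  ≡⟨ sum₃ g (δ t f) (δ u f) ⟩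
  sum g + (sum (δ t f) + sum (δ u f))     ≡⟨ cong (sum g +_) (cong₂ _+_ (∑-δ t f) (∑-δ u f)) ⟩
  sum g + (f t + f u)                     ∎
  where
  open ≤-Reasoning
  δ : Fin n → (Fin n → ℕ) → Fin n → ℕ
  δ t h i = 𝟙 (i ≟ t) * h i
  sum₃ : ∀ (h₁ h₂ h₃ : Fin n → ℕ) → ∑[ i < n ] (h₁ i + (h₂ i + h₃ i)) ≡ sum h₁ + (sum h₂ + sum h₃)
  sum₃ h₁ h₂ h₃ = trans (∑-distrib-+ h₁ _) (cong (sum h₁ +_) (∑-distrib-+ h₂ h₃))
  -- 𝟙 (i ≟ t) * h i reduces to h i + 0 or to 0 once i ≟ t is decided, hence these shapes.
  swap₁ : ∀ a b → a + (b + 0 + 0) ≡ b + (a + 0 + 0)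
  swap₁ = solve-∀
  swap₂ : ∀ a b → a + (b + 0) ≡ b + (a + 0)
  swap₂ = solve-∀
  pointwise : ∀ i → f i + (δ t g i + δ u g i) ≤ g i + (δ t f i + δ u f i)
  pointwise i with i ≟ t | i ≟ u
  ... | yes refl | yes refl = contradiction refl t≢u
  ... | yes refl | no _ = ≤-reflexive (swap₁ (f i) (g i))
  ... | no _ | yes refl = ≤-reflexive (swap₂ (f i) (g i))
  ... | no i≢t | no i≢u = +-monoˡ-≤ 0 (f≤g i i≢t i≢u)

module _ {a p} {A : Set a} {P : Pred A p} (P? : Decidable P) where

  length-filter-map : ∀ {b} {B : Set b} (f : B → A) xs → length (filter P? (map f xs)) ≡ length (filter (P? ∘ f) xs)
  length-filter-map f [] = refl
  length-filter-map f (x ∷ xs) with does (P? (f x))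
  ... | true = cong suc (length-filter-map f xs)
  ... | false = length-filter-map f xs

  length-filter-tabulate : ∀ {n} (f : Fin n → A) → length (filter P? (tabulate f)) ≡ ∑[ i < n ] 𝟙 (P? (f i))
  length-filter-tabulate {zero} f = refl
  length-filter-tabulate {suc n} f with does (P? (f zero))
  ... | true = cong suc (length-filter-tabulate (f ∘ suc))
  ... | false = length-filter-tabulate (f ∘ suc)

length-filter-allFin² : ∀ {n p} {P : Pred (Fin n × Fin n) p} (P? : Decidable P) →
  length (filter P? (cartesianProduct (allFin n) (allFin n))) ≡ ∑[ i < n ] ∑[ j < n ] 𝟙 (P? (i , j))
length-filter-allFin² {n} P? = rows (λ i → i)
  where
  rows : ∀ {m} (f : Fin m → Fin n) →
         length (filter P? (cartesianProduct (tabulate f) (allFin n))) ≡ ∑[ i < m ] ∑[ j < n ] 𝟙 (P? (f i , j))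
  rows {zero} f = refl
  rows {suc m} f = begin
    length (filter P? (row ++ rest))                          ≡⟨ cong length (filter-++ P? row rest) ⟩
    length (filter P? row ++ filter P? rest)                  ≡⟨ length-++ (filter P? row) ⟩
    length (filter P? row) + length (filter P? rest)          ≡⟨ cong₂ _+_ first-row (rows (f ∘ suc)) ⟩
    ∑[ j < n ] 𝟙 (P? (f zero , j)) + ∑[ i < m ] ∑[ j < n ] 𝟙 (P? (f (suc i) , j)) ∎
    where
    open ≡-Reasoning
    row = map (f zero ,_) (allFin n)
    rest = cartesianProduct (tabulate (f ∘ suc)) (allFin n)
    first-row : length (filter P? row) ≡ ∑[ j < n ] 𝟙 (P? (f zero , j))
    first-row = trans (length-filter-map P? (f zero ,_) (allFin n)) (length-filter-tabulate (P? ∘ (f zero ,_)) (λ j → j))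

∣p∣≡∑𝟙∈ : ∀ {n} (p : Subset n) → ∣ p ∣ ≡ ∑[ i < n ] 𝟙 (i ∈? p)
∣p∣≡∑𝟙∈ [] = refl
∣p∣≡∑𝟙∈ (inside ∷ p) = cong suc (∣p∣≡∑𝟙∈ p)
∣p∣≡∑𝟙∈ (outside ∷ p) = ∣p∣≡∑𝟙∈ p

x∉p-x : ∀ {n} (p : Subset n) x → x ∉ p - x
x∉p-x (_ ∷ p) zero ()
x∉p-x (_ ∷ p) (suc x) = x∉p-x p x ∘ drop-there

x∈p⇒∣p∣≡1+∣p-x∣ : ∀ {n} {p : Subset n} {x} → x ∈ p → ∣ p ∣ ≡ suc ∣ p - x ∣
x∈p⇒∣p∣≡1+∣p-x∣ {n} {p} {x} x∈p = begin
  ∣ p ∣                                             ≡⟨ ∣p∣≡∑𝟙∈ p ⟩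
  ∑[ i < n ] 𝟙 (i ∈? p)                             ≡⟨ sum-cong-≗ split ⟩
  ∑[ i < n ] (𝟙 (i ≟ x) + 𝟙 (i ∈? p - x))           ≡⟨ ∑-distrib-+ (𝟙 ∘ (_≟ x)) (𝟙 ∘ (_∈? p - x)) ⟩
  ∑[ i < n ] 𝟙 (i ≟ x) + ∑[ i < n ] 𝟙 (i ∈? p - x)  ≡⟨ cong₂ _+_ (∑𝟙≟ x) (sym (∣p∣≡∑𝟙∈ (p - x))) ⟩
  suc ∣ p - x ∣                                     ∎
  where
  open ≡-Reasoning
  split : ∀ i → 𝟙 (i ∈? p) ≡ 𝟙 (i ≟ x) + 𝟙 (i ∈? p - x)
  split i with i ≟ x
  ... | yes refl = trans (𝟙-yes (i ∈? p) x∈p) (cong suc (sym (𝟙-no (i ∈? p - i) (x∉p-x p i))))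
  ... | no i≢x with i ∈? p | i ∈? p - x
  ...   | yes i∈p | no i∉p-x = contradiction (x∈p∧x≢y⇒x∈p-y i∈p i≢x) i∉p-x
  ...   | no i∉p | yes i∈p-x = contradiction (p─q⊆p p ⁅ x ⁆ i∈p-x) i∉p
  ...   | yes _ | yes _ = refl
  ...   | no _ | no _ = refl

nonempty : ∀ {n} {p : Subset n} → 1 ≤ ∣ p ∣ → Nonempty p
nonempty {n} {p} 1≤∣p∣ with nonempty? p
... | yes ne = ne
... | no empty = contradiction (trans (cong ∣_∣ (Empty-unique empty)) (∣⊥∣≡0 n)) (>⇒≢ 1≤∣p∣)

module _ {c ℓ₁ ℓ₂} (O : TotalOrder c ℓ₁ ℓ₂) where

  private
    module O = TotalOrder O
  open Extrema O using (argmax; argmin; argmax-all; argmin-all; f[xs]≤f[argmax]; f[argmin]≤f[xs])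

  module _ {n p} {P : Pred (Fin n) p} (P? : Decidable P) (f : Fin n → O.Carrier) where

    maximiser : ∃ P → ∃ λ j → P j × (∀ {k} → P k → f k O.≤ f j)
    maximiser (i , Pi) = argmax f i xs , argmax-all f Pi (all-filter P? (allFin n)) ,
      λ {k} Pk → lookup (f[xs]≤f[argmax] i xs) (∈-filter⁺ P? (∈-allFin k) Pk)
      where xs = filter P? (allFin n)

    minimiser : ∃ P → ∃ λ j → P j × (∀ {k} → P k → f j O.≤ f k)
    minimiser (i , Pi) = argmin f i xs , argmin-all f Pi (all-filter P? (allFin n)) ,
      λ {k} Pk → lookup (f[argmin]≤f[xs] i xs) (∈-filter⁺ P? (∈-allFin k) Pk)
      where xs = filter P? (allFin n)

[2+k]²/4≡k²/4+1+k : ∀ k → (2 + k) * (2 + k) / 4 ≡ k * k / 4 + suc k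
[2+k]²/4≡k²/4+1+k k = begin
  (2 + k) * (2 + k) / 4      ≡⟨ /-congˡ (expand k) ⟩
  (k * k + suc k * 4) / 4    ≡⟨ +-distrib-/-∣ʳ (k * k) (divides (suc k) refl) ⟩
  k * k / 4 + suc k * 4 / 4  ≡⟨ cong (k * k / 4 +_) (m*n/n≡m (suc k) 4) ⟩
  k * k / 4 + suc k          ∎
  where
  open ≡-Reasoning
  expand : ∀ k → (2 + k) * (2 + k) ≡ k * k + suc k * 4
  expand = solve-∀

bound-2+ : ∀ k → bound (2 + k) ≡ (2 + k) * (2 + k) / 4 + k
bound-2+ k = +-∸-assoc ((2 + k) * (2 + k) / 4) {2 + k} (s≤s (s≤s z≤n))

bound-step : ∀ k {c} → c ≤ 2 → c ≤ k → bound k + k + 1 + c ≤ bound (2 + k)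
bound-step zero z≤n _ = s≤s z≤n
bound-step (suc zero) _ z≤n = s≤s (s≤s z≤n)
bound-step (suc zero) _ (s≤s z≤n) = s≤s (s≤s (s≤s z≤n))
bound-step (suc (suc j)) {c} c≤2 _ = begin
  bound (2 + j) + (2 + j) + 1 + c              ≡⟨ cong (λ b → b + (2 + j) + 1 + c) (bound-2+ j) ⟩
  q + j + (2 + j) + 1 + c                      ≤⟨ +-monoʳ-≤ (q + j + (2 + j) + 1) c≤2 ⟩
  q + j + (2 + j) + 1 + 2                      ≡⟨ rearrange q j ⟩
  q + suc (2 + j) + (2 + j)                    ≡⟨ cong (_+ (2 + j)) ([2+k]²/4≡k²/4+1+k (2 + j)) ⟨
  (2 + (2 + j)) * (2 + (2 + j)) / 4 + (2 + j)  ≡⟨ bound-2+ (2 + j) ⟨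
  bound (2 + (2 + j))                          ∎
  where
  open ≤-Reasoning
  q : ℕ
  q = (2 + j) * (2 + j) / 4
  rearrange : ∀ q j → q + j + (2 + j) + 1 + 2 ≡ q + suc (2 + j) + (2 + j)
  rearrange = solve-∀

n/2*[n∸n/2]≡n²/4 : ∀ n → n / 2 * (n ∸ n / 2) ≡ n * n / 4
n/2*[n∸n/2]≡n²/4 zero = refl
n/2*[n∸n/2]≡n²/4 (suc zero) = refl
n/2*[n∸n/2]≡n²/4 (suc (suc n)) = begin
  (2 + n) / 2 * (2 + n ∸ (2 + n) / 2)  ≡⟨ cong (λ h → h * (2 + n ∸ h)) [2+n]/2≡1+h ⟩
  suc h * (suc n ∸ h)                  ≡⟨ cong (suc h *_) (+-∸-assoc 1 h≤n) ⟩
  suc h * suc (n ∸ h)                  ≡⟨ expand h (n ∸ h) ⟩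
  h * (n ∸ h) + (h + (n ∸ h)) + 1      ≡⟨ cong₂ (λ u v → u + v + 1) (n/2*[n∸n/2]≡n²/4 n) (m+[n∸m]≡n h≤n) ⟩
  n * n / 4 + n + 1                    ≡⟨ reorder (n * n / 4) n ⟩
  n * n / 4 + suc n                    ≡⟨ [2+k]²/4≡k²/4+1+k n ⟨
  (2 + n) * (2 + n) / 4                ∎
  where
  open ≡-Reasoning
  h : ℕ
  h = n / 2
  h≤n : h ≤ n
  h≤n = m/n≤m n 2
  [2+n]/2≡1+h : (2 + n) / 2 ≡ suc h
  [2+n]/2≡1+h = m/n≡1+[m∸n]/n {2 + n} {2} (s≤s (s≤s z≤n))
  expand : ∀ a b → suc a * suc b ≡ a * b + (a + b) + 1
  expand = solve-∀
  reorder : ∀ q n → q + n + 1 ≡ q + suc n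
  reorder = solve-∀

bound≡n/2*[n∸n/2]+[n∸2] : ∀ {n} → 2 ≤ n → bound n ≡ n / 2 * (n ∸ n / 2) + (n ∸ 2)
bound≡n/2*[n∸n/2]+[n∸2] {n} 2≤n = trans (+-∸-assoc (n * n / 4) 2≤n) (cong (_+ (n ∸ 2)) (sym (n/2*[n∸n/2]≡n²/4 n)))

module HereditaryGraph {n ℓ} (Adj : Subset n → Fin n → Fin n → Set ℓ)
  (adj? : ∀ p i j → Dec (Adj p i j))
  (adj-sym : ∀ {p i j} → Adj p i j → Adj p j i)
  (adj-∈ : ∀ {p i j} → Adj p i j → i ∈ p)
  (adj-irrefl : ∀ {p i j} → Adj p i j → i ≢ j)
  (adj-remove : ∀ {p i j k} → Adj p i j → i ≢ k → j ≢ k → Adj (p - k) i j)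
  where

  deg : Subset n → Fin n → ℕ
  deg p i = ∑[ j < n ] 𝟙 (adj? p i j)

  degreeSum : Subset n → ℕ
  degreeSum p = ∑[ i < n ] deg p i

  commonNeighbours : Subset n → Fin n → Fin n → ℕ
  commonNeighbours p i j = ∑[ k < n ] 𝟙 (adj? p i k ×-dec adj? p j k)

  ThinEdge : Subset n → Set ℓ
  ThinEdge p = ∃₂ λ T s → Adj p T s × commonNeighbours p T s ≤ 2

  𝟙-adj-sym : ∀ p i j → 𝟙 (adj? p i j) ≡ 𝟙 (adj? p j i)
  𝟙-adj-sym p i j = ≤-antisym (𝟙-mono (adj? p i j) (adj? p j i) adj-sym) (𝟙-mono (adj? p j i) (adj? p i j) adj-sym)

  ∑-column : ∀ p t → ∑[ i < n ] 𝟙 (adj? p i t) ≡ deg p t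
  ∑-column p t = sum-cong-≗ (λ i → 𝟙-adj-sym p i t)

  ∣p∣≡2+∣p-i-j∣ : ∀ {p i j} → Adj p i j → ∣ p ∣ ≡ 2 + ∣ p - i - j ∣
  ∣p∣≡2+∣p-i-j∣ i~j = trans (x∈p⇒∣p∣≡1+∣p-x∣ (adj-∈ i~j))
    (cong suc (x∈p⇒∣p∣≡1+∣p-x∣ (x∈p∧x≢y⇒x∈p-y (adj-∈ (adj-sym i~j)) (adj-irrefl (adj-sym i~j)))))

  ∣p∣≤1⇒degreeSum≡0 : ∀ p → ∣ p ∣ ≤ 1 → degreeSum p ≡ 0
  ∣p∣≤1⇒degreeSum≡0 p ∣p∣≤1 = sum-zero λ i → sum-zero λ j → 𝟙-no (adj? p i j) λ i~j →
    contradiction (≤-trans (≤-reflexive (sym (∣p∣≡2+∣p-i-j∣ i~j))) ∣p∣≤1) λ { (s≤s ()) }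

  module _ {p : Subset n} {T s : Fin n} (T~s : Adj p T s) where

    private
      T≢s : T ≢ s
      T≢s = adj-irrefl T~s

    adj-remove₂ : ∀ {i j} → Adj p i j → i ≢ T → i ≢ s → j ≢ T → j ≢ s → Adj (p - T - s) i j
    adj-remove₂ i~j i≢T i≢s j≢T j≢s = adj-remove (adj-remove i~j i≢T j≢T) i≢s j≢s

    deg-remove₂ : ∀ {i} → i ≢ T → i ≢ s → deg p i ≤ deg (p - T - s) i + (𝟙 (adj? p i T) + 𝟙 (adj? p i s))
    deg-remove₂ {i} i≢T i≢s = ≤-trans (m≤m+n (deg p i) _) (sum-≤-except₂ T≢s λ j j≢T j≢s →
      𝟙-mono (adj? p i j) (adj? (p - T - s) i j) λ i~j → adj-remove₂ i~j i≢T i≢s j≢T j≢s)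

    degreeSum-remove₂ : degreeSum p + 2 ≤ degreeSum (p - T - s) + 2 * (deg p T + deg p s)
    degreeSum-remove₂ = begin
      degreeSum p + 2                ≤⟨ +-monoʳ-≤ (degreeSum p) (+-mono-≤ 1≤g[T] 1≤g[s]) ⟩
      degreeSum p + (g T + g s)      ≤⟨ sum-≤-except₂ T≢s (λ i → deg-remove₂) ⟩
      sum g + w                      ≡⟨ cong (_+ w) ∑g≡ ⟩
      degreeSum (p - T - s) + w + w  ≡⟨ double (degreeSum (p - T - s)) w ⟩
      degreeSum (p - T - s) + 2 * w  ∎
      where
      open ≤-Reasoning
      w : ℕ
      w = deg p T + deg p s
      g : Fin n → ℕ
      g i = deg (p - T - s) i + (𝟙 (adj? p i T) + 𝟙 (adj? p i s))
      1≤g[T] : 1 ≤ g T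
      1≤g[T] = ≤-trans (≤-reflexive (sym (𝟙-yes (adj? p T s) T~s)))
                       (≤-trans (m≤n+m _ (𝟙 (adj? p T T))) (m≤n+m _ (deg (p - T - s) T)))
      1≤g[s] : 1 ≤ g s
      1≤g[s] = ≤-trans (≤-reflexive (sym (𝟙-yes (adj? p s T) (adj-sym T~s))))
                       (≤-trans (m≤m+n _ (𝟙 (adj? p s s))) (m≤n+m _ (deg (p - T - s) s)))
      ∑g≡ : sum g ≡ degreeSum (p - T - s) + w
      ∑g≡ = trans (∑-distrib-+ (deg (p - T - s)) _) (cong (degreeSum (p - T - s) +_)
              (trans (∑-distrib-+ (λ i → 𝟙 (adj? p i T)) (λ i → 𝟙 (adj? p i s)))
                     (cong₂ _+_ (∑-column p T) (∑-column p s))))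
      double : ∀ d w → d + w + w ≡ d + 2 * w
      double = solve-∀

  deg+deg≤∣p∣+common : ∀ p T s → deg p T + deg p s ≤ ∣ p ∣ + commonNeighbours p T s
  deg+deg≤∣p∣+common p T s = begin
    deg p T + deg p s                                           ≡⟨ ∑-distrib-+ (𝟙 ∘ adj? p T) (𝟙 ∘ adj? p s) ⟨
    ∑[ j < n ] (𝟙 (adj? p T j) + 𝟙 (adj? p s j))               ≤⟨ sum-mono-≤ pointwise ⟩
    ∑[ j < n ] (𝟙 (j ∈? p) + 𝟙 (adj? p T j ×-dec adj? p s j))  ≡⟨ ∑-distrib-+ (𝟙 ∘ (_∈? p)) _ ⟩
    ∑[ j < n ] 𝟙 (j ∈? p) + commonNeighbours p T s              ≡⟨ cong (_+ commonNeighbours p T s) (∣p∣≡∑𝟙∈ p) ⟨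
    ∣ p ∣ + commonNeighbours p T s                              ∎
    where
    open ≤-Reasoning
    1≤𝟙∈ : ∀ {u j} → Adj p u j → 1 ≤ 𝟙 (j ∈? p)
    1≤𝟙∈ {j = j} u~j = ≤-reflexive (sym (𝟙-yes (j ∈? p) (adj-∈ (adj-sym u~j))))
    pointwise : ∀ j → 𝟙 (adj? p T j) + 𝟙 (adj? p s j) ≤ 𝟙 (j ∈? p) + 𝟙 (adj? p T j ×-dec adj? p s j)
    pointwise j with adj? p T j | adj? p s j
    ... | yes T~j | yes _ = +-monoˡ-≤ 1 (1≤𝟙∈ T~j)
    ... | yes T~j | no _ = +-monoˡ-≤ 0 (1≤𝟙∈ T~j)
    ... | no _ | yes s~j = +-monoˡ-≤ 0 (1≤𝟙∈ s~j)
    ... | no _ | no _ = z≤n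

  common≤∣p-T-s∣ : ∀ p T s → commonNeighbours p T s ≤ ∣ p - T - s ∣
  common≤∣p-T-s∣ p T s = ≤-trans (sum-mono-≤ λ j → 𝟙-mono (adj? p T j ×-dec adj? p s j) (j ∈? p - T - s) common∈)
                                  (≤-reflexive (sym (∣p∣≡∑𝟙∈ (p - T - s))))
    where
    common∈ : ∀ {j} → Adj p T j × Adj p s j → j ∈ p - T - s
    common∈ (T~j , s~j) = x∈p∧x≢y⇒x∈p-y (x∈p∧x≢y⇒x∈p-y (adj-∈ (adj-sym T~j)) (adj-irrefl (adj-sym T~j)))
                                          (adj-irrefl (adj-sym s~j))

  degreeSum≤2*bound : (∀ p → 2 ≤ ∣ p ∣ → ThinEdge p) → ∀ p → degreeSum p ≤ 2 * bound ∣ p ∣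
  degreeSum≤2*bound thin-edge p = go ∣ p ∣ p refl
    where
    go : ∀ k p → ∣ p ∣ ≡ k → degreeSum p ≤ 2 * bound k
    go zero p ∣p∣≡0 = ≤-trans (≤-reflexive (∣p∣≤1⇒degreeSum≡0 p (≤-trans (≤-reflexive ∣p∣≡0) z≤n))) z≤n
    go (suc zero) p ∣p∣≡1 = ≤-trans (≤-reflexive (∣p∣≤1⇒degreeSum≡0 p (≤-reflexive ∣p∣≡1))) z≤n
    go (suc (suc k)) p ∣p∣≡2+k with thin-edge p (≤-trans (s≤s (s≤s z≤n)) (≤-reflexive (sym ∣p∣≡2+k)))
    ... | T , s , T~s , c≤2 = +-cancelʳ-≤ 2 (degreeSum p) (2 * bound (2 + k)) (begin
      degreeSum p + 2                  ≤⟨ degreeSum-remove₂ T~s ⟩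
      degreeSum p′ + 2 * w             ≤⟨ +-mono-≤ (go k p′ ∣p′∣≡k) (*-monoʳ-≤ 2 w≤2+k+c) ⟩
      2 * bound k + 2 * (2 + k + c)    ≡⟨ regroup (bound k) k c ⟩
      2 * (bound k + k + 1 + c) + 2    ≤⟨ +-monoˡ-≤ 2 (*-monoʳ-≤ 2 (bound-step k c≤2 c≤k)) ⟩
      2 * bound (2 + k) + 2            ∎)
      where
      open ≤-Reasoning
      p′ : Subset n
      p′ = p - T - s
      c w : ℕ
      c = commonNeighbours p T s
      w = deg p T + deg p s
      ∣p′∣≡k : ∣ p′ ∣ ≡ k
      ∣p′∣≡k = suc-injective (suc-injective (trans (sym (∣p∣≡2+∣p-i-j∣ T~s)) ∣p∣≡2+k))
      w≤2+k+c : w ≤ 2 + k + c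
      w≤2+k+c = ≤-trans (deg+deg≤∣p∣+common p T s) (≤-reflexive (cong (_+ c) ∣p∣≡2+k))
      c≤k : c ≤ k
      c≤k = ≤-trans (common≤∣p-T-s∣ p T s) (≤-reflexive ∣p′∣≡k)
      regroup : ∀ b k c → 2 * b + 2 * (2 + k + c) ≡ 2 * (b + k + 1 + c) + 2
      regroup = solve-∀

module Betweenness {o ℓ₁ ℓ₂} (O : StrictTotalOrder o ℓ₁ ℓ₂) where

  open StrictTotalOrder O using (Carrier; _≈_; _<_; compare) renaming (trans to <-trans; asym to <-asym)

  Between : Carrier → Carrier → Carrier → Set ℓ₂
  Between a b c = (a < c × c < b) ⊎ (b < c × c < a)

  between-sym : ∀ {a b c} → Between a b c → Between b a c
  between-sym (inj₁ a<c<b) = inj₂ a<c<b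
  between-sym (inj₂ b<c<a) = inj₁ b<c<a

  between-trichotomy : ∀ {a b c} → ¬ a ≈ b → ¬ b ≈ c → ¬ a ≈ c → Between a b c ⊎ Between a c b ⊎ Between b c a
  between-trichotomy {a} {b} {c} a≉b b≉c a≉c with compare a b | compare b c | compare a c
  ... | tri≈ _ a≈b _ | _ | _ = contradiction a≈b a≉b
  ... | _ | tri≈ _ b≈c _ | _ = contradiction b≈c b≉c
  ... | _ | _ | tri≈ _ a≈c _ = contradiction a≈c a≉c
  ... | tri< a<b _ _ | tri< b<c _ _ | _            = inj₂ (inj₁ (inj₁ (a<b , b<c)))
  ... | tri< _ _ _   | tri> _ _ c<b | tri< a<c _ _ = inj₁ (inj₁ (a<c , c<b))
  ... | tri< a<b _ _ | tri> _ _ _   | tri> _ _ c<a = inj₂ (inj₂ (inj₂ (c<a , a<b)))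
  ... | tri> _ _ b<a | tri< _ _ _   | tri< a<c _ _ = inj₂ (inj₂ (inj₁ (b<a , a<c)))
  ... | tri> _ _ _   | tri< b<c _ _ | tri> _ _ c<a = inj₁ (inj₂ (b<c , c<a))
  ... | tri> _ _ b<a | tri> _ _ c<b | _            = inj₂ (inj₁ (inj₂ (c<b , b<a)))

  between-shrink : ∀ {a b c d} → Between a b c → Between c b d → Between a d c
  between-shrink (inj₁ (a<c , c<b)) (inj₁ (c<d , d<b)) = inj₁ (a<c , c<d)
  between-shrink (inj₁ (a<c , c<b)) (inj₂ (b<d , d<c)) = contradiction (<-trans b<d d<c) (<-asym c<b)
  between-shrink (inj₂ (b<c , c<a)) (inj₁ (c<d , d<b)) = contradiction (<-trans c<d d<b) (<-asym b<c)
  between-shrink (inj₂ (b<c , c<a)) (inj₂ (b<d , d<c)) = inj₂ (d<c , c<a)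

  between-extend : ∀ {a b c d} → Between a b c → Between d c b → Between a d c
  between-extend (inj₁ (a<c , c<b)) (inj₁ (d<b , b<c)) = contradiction b<c (<-asym c<b)
  between-extend (inj₁ (a<c , c<b)) (inj₂ (_ , b<d))   = inj₁ (a<c , <-trans c<b b<d)
  between-extend (inj₂ (b<c , c<a)) (inj₁ (d<b , _))   = inj₂ (<-trans d<b b<c , c<a)
  between-extend (inj₂ (b<c , c<a)) (inj₂ (c<b , _))   = contradiction b<c (<-asym c<b)

  between-lower : ∀ {a b c} → b < a → Between a b c → b < c × c < a
  between-lower b<a (inj₁ (a<c , c<b)) = contradiction (<-trans a<c c<b) (<-asym b<a)
  between-lower b<a (inj₂ b<c<a) = b<c<a

  ¬between⇒< : ∀ {a b c} → ¬ Between a b c → c < b → ¬ a ≈ c → c < a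
  ¬between⇒< {a} {b} {c} ¬between c<b a≉c with compare a c
  ... | tri< a<c _ _ = contradiction (inj₁ (a<c , c<b)) ¬between
  ... | tri≈ _ a≈c _ = contradiction a≈c a≉c
  ... | tri> _ _ c<a = c<a

  ¬between-above : ∀ {a b c} → a < c → b < c → ¬ Between a b c
  ¬between-above a<c b<c (inj₁ (_ , c<b)) = <-asym c<b b<c
  ¬between-above a<c b<c (inj₂ (_ , c<a)) = <-asym c<a a<c

  ¬between-below : ∀ {a b c} → c < a → c < b → ¬ Between a b c
  ¬between-below c<a c<b (inj₁ (a<c , _)) = <-asym a<c c<a
  ¬between-below c<a c<b (inj₂ (b<c , _)) = <-asym b<c c<b

open Betweenness ℚ.<-strictTotalOrder

⊓⊔⇒between : ∀ {a b c} → a ℚ.⊓ b ℚ.< c × c ℚ.< a ℚ.⊔ b → Between a b c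
⊓⊔⇒between {a} {b} {c} (a⊓b<c , c<a⊔b) with ℚ.≤-total a b
... | inj₁ a≤b = inj₁ (subst (ℚ._< c) (ℚ.p≤q⇒p⊓q≡p a≤b) a⊓b<c ,
                      subst (c ℚ.<_) (ℚ.p≤q⇒p⊔q≡q a≤b) c<a⊔b)
... | inj₂ b≤a = inj₂ (subst (ℚ._< c) (ℚ.p≥q⇒p⊓q≡q b≤a) a⊓b<c ,
                      subst (c ℚ.<_) (ℚ.p≥q⇒p⊔q≡p b≤a) c<a⊔b)

between⇒⊓⊔ : ∀ {a b c} → Between a b c → a ℚ.⊓ b ℚ.< c × c ℚ.< a ℚ.⊔ b
between⇒⊓⊔ {a} {b} {c} (inj₁ (a<c , c<b)) = let a≤b = ℚ.<⇒≤ (ℚ.<-trans a<c c<b) in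
  subst (ℚ._< c) (sym (ℚ.p≤q⇒p⊓q≡p a≤b)) a<c , subst (c ℚ.<_) (sym (ℚ.p≤q⇒p⊔q≡q a≤b)) c<b
between⇒⊓⊔ {a} {b} {c} (inj₂ (b<c , c<a)) = let b≤a = ℚ.<⇒≤ (ℚ.<-trans b<c c<a) in
  subst (ℚ._< c) (sym (ℚ.p≥q⇒p⊓q≡q b≤a)) b<c , subst (c ℚ.<_) (sym (ℚ.p≥q⇒p⊔q≡p b≤a)) c<a

<⇒≱ : ∀ {a b} → a ℚ.< b → ¬ b ℚ.≤ a
<⇒≱ a<b b≤a = ℚ.<-irrefl refl (ℚ.<-≤-trans a<b b≤a)

≤∧≢⇒< : ∀ {a b} → a ℚ.≤ b → a ≢ b → a ℚ.< b
≤∧≢⇒< {a} {b} a≤b a≢b with ℚ.<-cmp a b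
... | tri< a<b _ _ = a<b
... | tri≈ _ a≡b _ = contradiction a≡b a≢b
... | tri> _ _ b<a = contradiction a≤b (<⇒≱ b<a)

ℚ-≤-totalOrder : TotalOrder 0ℓ 0ℓ 0ℓ
ℚ-≤-totalOrder = DecTotalOrder.totalOrder ℚ.≤-decTotalOrder

interior-sym : ∀ {p q r} → InInterior p q r → InInterior q p r
interior-sym {p} {q} ((x₁ , x₂) , (y₁ , y₂)) =
  (subst (ℚ._< _) (ℚ.⊓-comm (proj₁ p) (proj₁ q)) x₁ , subst (_ ℚ.<_) (ℚ.⊔-comm (proj₁ p) (proj₁ q)) x₂) ,
  (subst (ℚ._< _) (ℚ.⊓-comm (proj₂ p) (proj₂ q)) y₁ , subst (_ ℚ.<_) (ℚ.⊔-comm (proj₂ p) (proj₂ q)) y₂)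

module RectangleGraph {n} (X : Fin n → Point) where

  x y : Fin n → ℚ
  x i = proj₁ (X i)
  y i = proj₂ (X i)

  record Adjacent (p : Subset n) (i j : Fin n) : Set where
    constructor adjacent
    field
      ∈ˡ : i ∈ p
      ∈ʳ : j ∈ p
      distinct : i ≢ j
      empty : ¬ ∃ λ k → k ∈ p × InInterior (X i) (X j) (X k)

  open Adjacent public

  adjacent? : ∀ p i j → Dec (Adjacent p i j)
  adjacent? p i j =
    map′ (λ (i∈p , j∈p , i≢j , e) → adjacent i∈p j∈p i≢j e)
         (λ (adjacent i∈p j∈p i≢j e) → i∈p , j∈p , i≢j , e)
         (i ∈? p ×-dec j ∈? p ×-dec ¬? (i ≟ j) ×-dec ¬? (any? λ k → k ∈? p ×-dec inInterior? (X i) (X j) (X k)))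

  adjacent-sym : ∀ {p i j} → Adjacent p i j → Adjacent p j i
  adjacent-sym {i = i} {j} (adjacent i∈p j∈p i≢j e) =
    adjacent j∈p i∈p (i≢j ∘ sym) λ (k , k∈p , int) → e (k , k∈p , interior-sym {X j} {X i} int)

  adjacent-remove : ∀ {p i j k} → Adjacent p i j → i ≢ k → j ≢ k → Adjacent (p - k) i j
  adjacent-remove {p} {k = k} (adjacent i∈p j∈p i≢j e) i≢k j≢k =
    adjacent (x∈p∧x≢y⇒x∈p-y i∈p i≢k) (x∈p∧x≢y⇒x∈p-y j∈p j≢k) i≢j
             λ (l , l∈p-k , int) → e (l , p─q⊆p p ⁅ k ⁆ l∈p-k , int)

  open HereditaryGraph Adjacent adjacent? adjacent-sym ∈ˡ distinct adjacent-remove public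

  adjacent-¬between : ∀ {p i j k} → Adjacent p i j → k ∈ p → Between (x i) (x j) (x k) → ¬ Between (y i) (y j) (y k)
  adjacent-¬between i~j k∈p bx by = empty i~j (_ , k∈p , between⇒⊓⊔ bx , between⇒⊓⊔ by)

  isEdge⇒adjacent : ∀ {i j} → IsEdge X (i , j) → Adjacent ⊤ i j
  isEdge⇒adjacent (i<j , e) = adjacent ∈⊤ ∈⊤ (<⇒≢ i<j) λ (k , _ , int) → e (k , int)

  2*span₂≤degreeSum : 2 * span₂ X ≤ degreeSum ⊤
  2*span₂≤degreeSum = begin
    2 * span₂ X                                       ≡⟨ cong (2 *_) (length-filter-allFin² (isEdge? X)) ⟩
    2 * S                                             ≡⟨ cong (S +_) (+-identityʳ S) ⟩
    S + S                                             ≡⟨ cong (S +_) (∑-comm e) ⟩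
    S + ∑[ i < n ] ∑[ j < n ] e j i                   ≡⟨ ∑-distrib-+ (λ i → ∑[ j < n ] e i j) (λ i → ∑[ j < n ] e j i) ⟨
    ∑[ i < n ] (∑[ j < n ] e i j + ∑[ j < n ] e j i)  ≡⟨ sum-cong-≗ (λ i → ∑-distrib-+ (e i) (λ j → e j i)) ⟨
    ∑[ i < n ] ∑[ j < n ] (e i j + e j i)             ≤⟨ sum-mono-≤ (λ i → sum-mono-≤ (pointwise i)) ⟩
    degreeSum ⊤                                       ∎
    where
    open ≤-Reasoning
    e : Fin n → Fin n → ℕ
    e i j = 𝟙 (isEdge? X (i , j))
    S : ℕ
    S = ∑[ i < n ] ∑[ j < n ] e i j
    pointwise : ∀ i j → e i j + e j i ≤ 𝟙 (adjacent? ⊤ i j)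
    pointwise i j = 𝟙-disjoint (isEdge? X (i , j)) (isEdge? X (j , i)) (adjacent? ⊤ i j)
      (λ (i<j , _) (j<i , _) → ℕ.<⇒≯ i<j j<i) isEdge⇒adjacent (adjacent-sym ∘ isEdge⇒adjacent)

  module _ (generic : Generic X) where

    private
      x-injective : ∀ {i j} → i ≢ j → x i ≢ x j
      x-injective i≢j = proj₁ (generic _ _ i≢j)
      y-injective : ∀ {i j} → i ≢ j → y i ≢ y j
      y-injective i≢j = proj₂ (generic _ _ i≢j)

    below-both : ∀ {p i j k} → Adjacent p i j → k ∈ p → k ≢ i → Between (x i) (x j) (x k) →
                 y k ℚ.< y j → y k ℚ.< y i
    below-both i~j k∈p k≢i bx yk<yj = ¬between⇒< (adjacent-¬between i~j k∈p bx) yk<yj (y-injective (k≢i ∘ sym))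

    module _ {p T s} (top : ∀ {k} → k ∈ p → k ≢ T → y k ℚ.< y T) (T~s : Adjacent p T s)
             (lowest : ∀ {k} → Adjacent p T k → y s ℚ.≤ y k) where

      Common : Fin n → Set
      Common j = Adjacent p T j × Adjacent p s j

      no-nested-common : ∀ {z₁ z₂} → Common z₁ → Common z₂ → z₁ ≢ z₂ → ¬ Between (x z₂) (x T) (x z₁)
      no-nested-common {z₁} {z₂} (T~z₁ , s~z₁) (T~z₂ , s~z₂) z₁≢z₂ x₁∈x₂T =
        [ T-inside , [ z₁-inside , s-inside ]′ ]′
          (between-trichotomy (x-injective s≢z₁) (x-injective z₁≢T) (x-injective s≢T))
        where
        z₁∈p : z₁ ∈ p
        z₁∈p = ∈ʳ T~z₁
        s∈p : s ∈ p
        s∈p = ∈ʳ T~s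
        s≢z₁ : s ≢ z₁
        s≢z₁ = distinct s~z₁
        z₁≢s : z₁ ≢ s
        z₁≢s = s≢z₁ ∘ sym
        z₁≢T : z₁ ≢ T
        z₁≢T = distinct T~z₁ ∘ sym
        s≢T : s ≢ T
        s≢T = distinct T~s ∘ sym
        y₁<y₂ : y z₁ ℚ.< y z₂
        y₁<y₂ = below-both (adjacent-sym T~z₂) z₁∈p z₁≢z₂ x₁∈x₂T (top z₁∈p z₁≢T)
        T-inside : ¬ Between (x s) (x z₁) (x T)
        T-inside xT∈sz₁ =
          <⇒≱ (below-both s~z₂ z₁∈p z₁≢s (between-sym (between-extend x₁∈x₂T xT∈sz₁)) y₁<y₂) (lowest T~z₁)
        z₁-inside : ¬ Between (x s) (x T) (x z₁)
        z₁-inside x₁∈sT = <⇒≱ (below-both (adjacent-sym T~s) z₁∈p z₁≢s x₁∈sT (top z₁∈p z₁≢T)) (lowest T~z₁)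
        s-inside : ¬ Between (x z₁) (x T) (x s)
        s-inside xs∈z₁T = adjacent-¬between (adjacent-sym s~z₂) z₁∈p (between-shrink x₁∈x₂T xs∈z₁T)
          (inj₂ (below-both (adjacent-sym T~z₁) s∈p s≢z₁ xs∈z₁T (top s∈p s≢T) , y₁<y₂))

      left-unique : ∀ {z₁ z₂} → Common z₁ × x z₁ ℚ.< x T → Common z₂ × x z₂ ℚ.< x T → z₁ ≡ z₂
      left-unique {z₁} {z₂} (c₁ , l₁) (c₂ , l₂) with z₁ ≟ z₂
      ... | yes z₁≡z₂ = z₁≡z₂
      ... | no z₁≢z₂ with ℚ.<-cmp (x z₁) (x z₂)
      ...   | tri< x₁<x₂ _ _ = contradiction (inj₁ (x₁<x₂ , l₂)) (no-nested-common c₂ c₁ (z₁≢z₂ ∘ sym))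
      ...   | tri≈ _ x₁≡x₂ _ = contradiction x₁≡x₂ (x-injective z₁≢z₂)
      ...   | tri> _ _ x₂<x₁ = contradiction (inj₁ (x₂<x₁ , l₁)) (no-nested-common c₁ c₂ z₁≢z₂)

      right-unique : ∀ {z₁ z₂} → Common z₁ × x T ℚ.< x z₁ → Common z₂ × x T ℚ.< x z₂ → z₁ ≡ z₂
      right-unique {z₁} {z₂} (c₁ , r₁) (c₂ , r₂) with z₁ ≟ z₂
      ... | yes z₁≡z₂ = z₁≡z₂
      ... | no z₁≢z₂ with ℚ.<-cmp (x z₁) (x z₂)
      ...   | tri< x₁<x₂ _ _ = contradiction (inj₂ (r₁ , x₁<x₂)) (no-nested-common c₁ c₂ z₁≢z₂)
      ...   | tri≈ _ x₁≡x₂ _ = contradiction x₁≡x₂ (x-injective z₁≢z₂)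
      ...   | tri> _ _ x₂<x₁ = contradiction (inj₂ (r₂ , x₂<x₁)) (no-nested-common c₂ c₁ (z₁≢z₂ ∘ sym))

      left-or-right : ∀ {j} → Common j → (Common j × x j ℚ.< x T) ⊎ (Common j × x T ℚ.< x j)
      left-or-right {j} c with ℚ.<-cmp (x j) (x T)
      ... | tri< l _ _ = inj₁ (c , l)
      ... | tri≈ _ e _ = contradiction e (x-injective (distinct (proj₁ c) ∘ sym))
      ... | tri> _ _ r = inj₂ (c , r)

      commonNeighbours≤2 : commonNeighbours p T s ≤ 2
      commonNeighbours≤2 = begin
        commonNeighbours p T s
          ≤⟨ sum-mono-≤ (λ j → 𝟙-split (common? j) (left? j) (right? j) left-or-right) ⟩
        ∑[ j < n ] (𝟙 (left? j) + 𝟙 (right? j))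
          ≡⟨ ∑-distrib-+ (𝟙 ∘ left?) (𝟙 ∘ right?) ⟩
        ∑[ j < n ] 𝟙 (left? j) + ∑[ j < n ] 𝟙 (right? j)
          ≤⟨ +-mono-≤ (∑𝟙≤1 left? left-unique) (∑𝟙≤1 right? right-unique) ⟩
        2 ∎
        where
        open ≤-Reasoning
        common? : ∀ j → Dec (Common j)
        common? j = adjacent? p T j ×-dec adjacent? p s j
        left? : ∀ j → Dec (Common j × x j ℚ.< x T)
        left? j = common? j ×-dec x j ℚ.<? x T
        right? : ∀ j → Dec (Common j × x T ℚ.< x j)
        right? j = common? j ×-dec x T ℚ.<? x j

    top-pair-adjacent : ∀ {p T j} → T ∈ p → (∀ {k} → k ∈ p → k ≢ T → y k ℚ.< y T) →
                        j ∈ p - T → (∀ {k} → k ∈ p - T → y k ℚ.≤ y j) → Adjacent p T j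
    top-pair-adjacent {p} {T} {j} T∈p top j∈p-T second =
      adjacent T∈p j∈p (j≢T ∘ sym) λ (k , k∈p , _ , y-int) →
        let (yj<yk , yk<yT) = between-lower (top j∈p j≢T) (⊓⊔⇒between y-int)
        in <⇒≱ yj<yk (second (x∈p∧x≢y⇒x∈p-y k∈p λ k≡T → ℚ.<-irrefl (cong y k≡T) yk<yT))
      where
      j∈p : j ∈ p
      j∈p = p─q⊆p p ⁅ T ⁆ j∈p-T
      j≢T : j ≢ T
      j≢T j≡T = x∉p-x p T (subst (_∈ p - T) j≡T j∈p-T)

    highest-strict : ∀ {p T} → (∀ {k} → k ∈ p → y k ℚ.≤ y T) → ∀ {k} → k ∈ p → k ≢ T → y k ℚ.< y T
    highest-strict highest k∈p k≢T = ≤∧≢⇒< (highest k∈p) (y-injective k≢T)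

    thin-edge : ∀ p → 2 ≤ ∣ p ∣ → ThinEdge p
    thin-edge p 2≤∣p∣
      with maximiser ℚ-≤-totalOrder (_∈? p) y (nonempty (≤-trans (s≤s z≤n) 2≤∣p∣))
    ... | T , T∈p , T-highest
      with maximiser ℚ-≤-totalOrder (_∈? p - T) y
             (nonempty (≤-pred (subst (2 ≤_) (x∈p⇒∣p∣≡1+∣p-x∣ T∈p) 2≤∣p∣)))
    ... | j , j∈p-T , j-highest
      with minimiser ℚ-≤-totalOrder (adjacent? p T) y
             (j , top-pair-adjacent T∈p (highest-strict T-highest) j∈p-T j-highest)
    ... | s , T~s , s-lowest = T , s , T~s , commonNeighbours≤2 (highest-strict T-highest) T~s s-lowest

    span₂≤bound : span₂ X ≤ bound n
    span₂≤bound = *-cancelˡ-≤ 2 (≤-trans 2*span₂≤degreeSum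
      (subst (λ k → degreeSum ⊤ ≤ 2 * bound k) (∣⊤∣≡n n) (degreeSum≤2*bound thin-edge ⊤)))

∑𝟙[i<a] : ∀ n {a} → a ≤ n → ∑[ i < n ] 𝟙 (toℕ i ℕ.<? a) ≡ a
∑𝟙[i<a] zero z≤n = refl
∑𝟙[i<a] (suc n) {zero} z≤n = sum-zero {n} (λ _ → refl)
∑𝟙[i<a] (suc n) {suc a} (s≤s a≤n) = cong suc (∑𝟙[i<a] n a≤n)

∑𝟙[i≮a] : ∀ n a → ∑[ i < n ] 𝟙 (¬? (toℕ i ℕ.<? a)) ≡ n ∸ a
∑𝟙[i≮a] zero a = sym (ℕ.0∸n≡0 a)
∑𝟙[i≮a] (suc n) zero = cong suc (∑𝟙[i≮a] n zero)
∑𝟙[i≮a] (suc n) (suc a) = ∑𝟙[i≮a] n a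

∑𝟙[i≡c×P] : ∀ n {p} {P : Pred ℕ p} (P? : Decidable P) c →
            ∑[ i < n ] 𝟙 (toℕ i ℕ.≟ c ×-dec P? (toℕ i)) ≡ 𝟙 (c ℕ.<? n ×-dec P? c)
∑𝟙[i≡c×P] zero P? c = refl
∑𝟙[i≡c×P] (suc n) P? zero = trans (cong (𝟙 (P? 0) +_) (sum-zero {n} (λ _ → refl))) (+-identityʳ _)
∑𝟙[i≡c×P] (suc n) P? (suc c) = ∑𝟙[i≡c×P] n (P? ∘ suc) c

∑𝟙[i<m×i≢c] : ∀ n {m c} → m ≤ n → c ℕ.< m →
               ∑[ i < n ] 𝟙 (toℕ i ℕ.<? m ×-dec ¬? (toℕ i ℕ.≟ c)) ≡ m ∸ 1
∑𝟙[i<m×i≢c] (suc n) {suc m} {zero} (s≤s m≤n) _ = begin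
  ∑[ i < n ] 𝟙 (toℕ i ℕ.<? m ×-dec ¬? (suc (toℕ i) ℕ.≟ 0))
    ≡⟨ sum-cong-≗ {n} (λ i → 𝟙-×-decˡ (toℕ i ℕ.<? m) (¬? (suc (toℕ i) ℕ.≟ 0)) λ ()) ⟩
  ∑[ i < n ] 𝟙 (toℕ i ℕ.<? m)
    ≡⟨ ∑𝟙[i<a] n m≤n ⟩
  m ∎
  where open ≡-Reasoning
∑𝟙[i<m×i≢c] (suc n) {suc (suc m)} {suc c} (s≤s m≤n) (s≤s c<m) = cong suc (∑𝟙[i<m×i≢c] n m≤n c<m)

∑∑𝟙[i<a×j≮a] : ∀ n {a} → a ≤ n →
                ∑[ i < n ] ∑[ j < n ] 𝟙 (toℕ i ℕ.<? a ×-dec ¬? (toℕ j ℕ.<? a)) ≡ a * (n ∸ a)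
∑∑𝟙[i<a×j≮a] n {a} a≤n = begin
  ∑[ i < n ] ∑[ j < n ] 𝟙 (i<a? i ×-dec ¬? (i<a? j))
    ≡⟨ sum-cong-≗ {n} (λ i → sum-cong-≗ {n} λ j → 𝟙-×-dec (i<a? i) (¬? (i<a? j))) ⟩
  ∑[ i < n ] ∑[ j < n ] (𝟙 (i<a? i) * 𝟙 (¬? (i<a? j)))
    ≡⟨ sum-cong-≗ {n} (λ i → *-distribˡ-sum {n} (𝟙 (i<a? i)) (𝟙 ∘ ¬? ∘ i<a?)) ⟨
  ∑[ i < n ] (𝟙 (i<a? i) * ∑[ j < n ] 𝟙 (¬? (i<a? j)))
    ≡⟨ sum-cong-≗ {n} (λ i → cong (𝟙 (i<a? i) *_) (∑𝟙[i≮a] n a)) ⟩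
  ∑[ i < n ] (𝟙 (i<a? i) * (n ∸ a))
    ≡⟨ *-distribʳ-sum {n} (n ∸ a) (𝟙 ∘ i<a?) ⟨
  ∑[ i < n ] 𝟙 (i<a? i) * (n ∸ a)
    ≡⟨ cong (_* (n ∸ a)) (∑𝟙[i<a] n a≤n) ⟩
  a * (n ∸ a) ∎
  where
  open ≡-Reasoning
  i<a? : ∀ i → Dec (toℕ i ℕ.< a)
  i<a? i = toℕ i ℕ.<? a

∑∑𝟙[j≡1+i×j≢a] : ∀ n {a} → 1 ≤ a → a ℕ.< n →
                 ∑[ i < n ] ∑[ j < n ] 𝟙 (toℕ j ℕ.≟ suc (toℕ i) ×-dec ¬? (toℕ j ℕ.≟ a)) ≡ n ∸ 2
∑∑𝟙[j≡1+i×j≢a] (suc n) {suc a} _ (s≤s a<n) = begin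
  ∑[ i < suc n ] ∑[ j < suc n ] 𝟙 (toℕ j ℕ.≟ suc (toℕ i) ×-dec ¬? (toℕ j ℕ.≟ suc a))
    ≡⟨ sum-cong-≗ {suc n} (λ i → ∑𝟙[i≡c×P] (suc n) (λ u → ¬? (u ℕ.≟ suc a)) (suc (toℕ i))) ⟩
  ∑[ i < suc n ] 𝟙 (toℕ i ℕ.<? n ×-dec ¬? (toℕ i ℕ.≟ a))
    ≡⟨ ∑𝟙[i<m×i≢c] (suc n) (ℕ.n≤1+n n) a<n ⟩
  n ∸ 1 ∎
  where open ≡-Reasoning

fromℕ : ℕ → ℚ
fromℕ t = ℚ.mkℚ (ℤ.+ t) 0 (coprime-sym (1-coprimeTo t))

fromℕ-injective : ∀ {a b} → fromℕ a ≡ fromℕ b → a ≡ b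
fromℕ-injective = cong (ℤ.∣_∣ ∘ ℚ.numerator)

fromℕ-mono-< : ∀ {a b} → a ℕ.< b → fromℕ a ℚ.< fromℕ b
fromℕ-mono-< {a} {b} a<b =
  ℚ.*<* (subst₂ ℤ._<_ (sym (ℤ.*-identityʳ (ℤ.+ a))) (sym (ℤ.*-identityʳ (ℤ.+ b))) (ℤ.+<+ a<b))

fromℕ-cancel-< : ∀ {a b} → fromℕ a ℚ.< fromℕ b → a ℕ.< b
fromℕ-cancel-< {a} {b} (ℚ.*<* a<b) =
  ℤ.drop‿+<+ (subst₂ ℤ._<_ (ℤ.*-identityʳ (ℤ.+ a)) (ℤ.*-identityʳ (ℤ.+ b)) a<b)

module TwoChains (n a : ℕ) where

  height : ℕ → ℕ
  height t with t ℕ.<? a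
  ... | yes _ = n + t
  ... | no _ = t

  height-< : ∀ {t} → t ℕ.< a → height t ≡ n + t
  height-< {t} t<a with t ℕ.<? a
  ... | yes _ = refl
  ... | no t≮a = contradiction t<a t≮a

  height-≮ : ∀ {t} → ¬ t ℕ.< a → height t ≡ t
  height-≮ {t} t≮a with t ℕ.<? a
  ... | yes t<a = contradiction t<a t≮a
  ... | no _ = refl

  X : Fin n → Point
  X i = fromℕ (toℕ i) , fromℕ (height (toℕ i))

  height-injective : ∀ {t u} → t ℕ.< n → u ℕ.< n → height t ≡ height u → t ≡ u
  height-injective {t} {u} t<n u<n eq with t ℕ.<? a | u ℕ.<? a
  ... | yes _ | yes _ = ℕ.+-cancelˡ-≡ n t u eq
  ... | no _ | no _ = eq
  ... | yes _ | no _ = contradiction (sym eq) (ℕ.<⇒≢ (ℕ.<-≤-trans u<n (ℕ.m≤m+n n t)))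
  ... | no _ | yes _ = contradiction eq (ℕ.<⇒≢ (ℕ.<-≤-trans t<n (ℕ.m≤m+n n u)))

  generic : Generic X
  generic i j i≢j = i≢j ∘ toℕ-injective ∘ fromℕ-injective ,
                    i≢j ∘ toℕ-injective ∘ height-injective (toℕ<n i) (toℕ<n j) ∘ fromℕ-injective

  x-between : ∀ {i j k} → toℕ i ℕ.< toℕ j → InInterior (X i) (X j) (X k) → toℕ i ℕ.< toℕ k × toℕ k ℕ.< toℕ j
  x-between i<j (x-int , _) =
    let (i<k , k<j) = between-lower (fromℕ-mono-< i<j) (between-sym (⊓⊔⇒between x-int))
    in fromℕ-cancel-< i<k , fromℕ-cancel-< k<j

  height-<-left : ∀ {t u} → t ℕ.< u → u ℕ.< a → height t ℕ.< height u
  height-<-left t<u u<a =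
    subst₂ ℕ._<_ (sym (height-< (ℕ.<-trans t<u u<a))) (sym (height-< u<a)) (ℕ.+-monoʳ-< n t<u)

  height-<-right : ∀ {t u} → ¬ t ℕ.< a → t ℕ.< u → height t ℕ.< height u
  height-<-right t≮a t<u =
    subst₂ ℕ._<_ (sym (height-≮ t≮a)) (sym (height-≮ λ u<a → t≮a (ℕ.<-trans t<u u<a))) t<u

  height-right<left : ∀ {t u} → t ℕ.< n → ¬ t ℕ.< a → u ℕ.< a → height t ℕ.< height u
  height-right<left {u = u} t<n t≮a u<a =
    subst₂ ℕ._<_ (sym (height-≮ t≮a)) (sym (height-< u<a)) (ℕ.<-≤-trans t<n (ℕ.m≤m+n n u))

  cross-edge : ∀ {i j} → toℕ i ℕ.< a → ¬ toℕ j ℕ.< a → IsEdge X (i , j)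
  cross-edge {i} {j} i<a j≮a = i<j , λ (k , int) →
    y-outside (x-between i<j int) (toℕ k ℕ.<? a) (⊓⊔⇒between (proj₂ int))
    where
    i<j : toℕ i ℕ.< toℕ j
    i<j = ℕ.<-≤-trans i<a (ℕ.≮⇒≥ j≮a)
    y-outside : ∀ {k} → toℕ i ℕ.< toℕ k × toℕ k ℕ.< toℕ j → Dec (toℕ k ℕ.< a) →
                ¬ Between (proj₂ (X i)) (proj₂ (X j)) (proj₂ (X k))
    y-outside {k} (i<k , _) (yes k<a) = ¬between-above
      (fromℕ-mono-< (height-<-left i<k k<a)) (fromℕ-mono-< (height-right<left (toℕ<n j) j≮a k<a))
    y-outside {k} (_ , k<j) (no k≮a) = ¬between-below
      (fromℕ-mono-< (height-right<left (toℕ<n k) k≮a i<a)) (fromℕ-mono-< (height-<-right k≮a k<j))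

  step-edge : ∀ {i j} → toℕ j ≡ suc (toℕ i) → IsEdge X (i , j)
  step-edge {i} {j} j≡1+i = i<j , λ (k , int) →
    let (i<k , k<j) = x-between i<j int in ℕ.<⇒≱ i<k (ℕ.≤-pred (subst (toℕ k ℕ.<_) j≡1+i k<j))
    where
    i<j : toℕ i ℕ.< toℕ j
    i<j = ℕ.≤-reflexive (sym j≡1+i)

  a*[n∸a]+[n∸2]≤span₂ : 1 ≤ a → a ℕ.< n → a * (n ∸ a) + (n ∸ 2) ≤ span₂ X
  a*[n∸a]+[n∸2]≤span₂ 1≤a a<n = begin
    a * (n ∸ a) + (n ∸ 2)
      ≡⟨ cong₂ _+_ (∑∑𝟙[i<a×j≮a] n (ℕ.<⇒≤ a<n)) (∑∑𝟙[j≡1+i×j≢a] n 1≤a a<n) ⟨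
    ∑[ i < n ] ∑[ j < n ] 𝟙 (cross? i j) + ∑[ i < n ] ∑[ j < n ] 𝟙 (step? i j)
      ≡⟨ ∑-distrib-+ (λ i → ∑[ j < n ] 𝟙 (cross? i j)) (λ i → ∑[ j < n ] 𝟙 (step? i j)) ⟨
    ∑[ i < n ] (∑[ j < n ] 𝟙 (cross? i j) + ∑[ j < n ] 𝟙 (step? i j))
      ≡⟨ sum-cong-≗ {n} (λ i → ∑-distrib-+ (λ j → 𝟙 (cross? i j)) (λ j → 𝟙 (step? i j))) ⟨
    ∑[ i < n ] ∑[ j < n ] (𝟙 (cross? i j) + 𝟙 (step? i j))
      ≤⟨ sum-mono-≤ (λ i → sum-mono-≤ λ j → 𝟙-disjoint (cross? i j) (step? i j) (isEdge? X (i , j))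
                                                        disjoint (λ (i<a , j≮a) → cross-edge i<a j≮a) (step-edge ∘ proj₁)) ⟩
    ∑[ i < n ] ∑[ j < n ] 𝟙 (isEdge? X (i , j))
      ≡⟨ length-filter-allFin² (isEdge? X) ⟨
    span₂ X ∎
    where
    open ℕ.≤-Reasoning
    cross? : ∀ i j → Dec (toℕ i ℕ.< a × ¬ toℕ j ℕ.< a)
    cross? i j = toℕ i ℕ.<? a ×-dec ¬? (toℕ j ℕ.<? a)
    step? : ∀ i j → Dec (toℕ j ≡ suc (toℕ i) × toℕ j ≢ a)
    step? i j = toℕ j ℕ.≟ suc (toℕ i) ×-dec ¬? (toℕ j ℕ.≟ a)
    disjoint : ∀ {i j : Fin n} → toℕ i ℕ.< a × ¬ toℕ j ℕ.< a → ¬ (toℕ j ≡ suc (toℕ i) × toℕ j ≢ a)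
    disjoint (i<a , j≮a) (j≡1+i , j≢a) = j≢a (ℕ.≤-antisym (subst (ℕ._≤ a) (sym j≡1+i) i<a) (ℕ.≮⇒≥ j≮a))

theorem1 : (n : ℕ) → 2 ≤ n →
    ((X : Fin n → Point) → Generic X → span₂ X ≤ bound n)
    × Σ (Fin n → Point) (λ X → Generic X × span₂ X ≡ bound n)
theorem1 n 2≤n = upper , X , generic , ≤-antisym (upper X generic) bound≤span₂
  where
  upper : (X : Fin n → Point) → Generic X → span₂ X ≤ bound n
  upper X = RectangleGraph.span₂≤bound X
  open TwoChains n (n / 2)
  n/2<n : n / 2 ℕ.< n
  n/2<n = m/n<m n 2 ⦃ ℕ.>-nonZero (≤-trans (s≤s z≤n) 2≤n) ⦄ (s≤s (s≤s z≤n))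
  bound≤span₂ : bound n ≤ span₂ X
  bound≤span₂ = ≤-trans (≤-reflexive (bound≡n/2*[n∸n/2]+[n∸2] 2≤n))
                        (a*[n∸a]+[n∸2]≤span₂ (m≥n⇒m/n>0 2≤n) n/2<n)
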